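{- $\mathbf{L}_{\mathbf{fbdc}}$ is strictly contained in the classical modal logic $\mathbf{K}$.
   Context: Formulas are built from a countably infinite set of atoms by $A::=p\mid (A\rightarrow A)\mid\top\mid\bot\mid(A\vee A)\mid(A\wedge A)\mid\square A\mid\lozenge A$; $\neg A$ abbreviates $A\rightarrow\bot$. An intuitionistic modal logic is a set of formulas closed under uniform substitution, containing the axioms of intuitionistic propositional logic, closed under modus ponens, containing (A1) $\square(p\rightarrow q)\rightarrow(\square p\rightarrow\square q)$, (A2) $\square(p\vee q)\rightarrow((\lozenge p\rightarrow\square q)\rightarrow\square q)$, (A3) $\lozenge(p\vee q)\rightarrow\lozenge p\vee\lozenge q$, (A4) $\neg\lozenge\bot$, and closed under (R1) from $p$ infer $\square p$, (R2) from $p\rightarrow q$ infer $\lozenge p\rightarrow\lozenge q$, (R3) from $\lozenge p\rightarrow q\vee\square(p\rightarrow r)$ infer $\lozenge p\rightarrow q\vee\lozenge r$. $\mathbf{L}_{\min}$ is the least one; $\mathbf{L}\oplus\Sigma$ the least one containing $\mathbf{L}$ and $\Sigma$. $\mathbf{L}_{\mathbf{fbdc}}=\mathbf{L}_{\min}\oplus\{\lozenge(p\rightarrow q)\rightarrow(\square p\rightarrow\lozenge q),\ (\lozenge p\rightarrow\square q)\rightarrow\square(p\rightarrow q),\ \square(p\vee q)\rightarrow\lozenge p\vee\square q\}$. $\mathbf{K}$ is the least normal classical modal logic in this language: the set of formulas valid in all classical Kripke frames $(W,R)$ (with $\square$ and $\lozenge$ interpreted as the usual universal and existential $R$-successor modalities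 and the connectives classically); equivalently the least set containing classical tautologies, $\square(p\rightarrow q)\rightarrow(\square p\rightarrow\square q)$ and $\lozenge p\leftrightarrow\neg\square\neg p$, closed under modus ponens, necessitation and uniform substitution. -}

module Defs where

open import Data.Nat using (ℕ)
open import Data.Bool using (Bool; true; false; _∧_; _∨_; not)
open import Relation.Binary.PropositionalEquality using (_≡_)

infixr 5 _⇒_
infixl 6 _∨'_
infixl 7 _∧'_
data Fm : Set where
  atom : ℕ → Fm
  _⇒_  : Fm → Fm → Fm
  ⊤'   : Fm
  ⊥'   : Fm
  _∨'_ : Fm → Fm → Fm
  _∧'_ : Fm → Fm → Fm
  □    : Fm → Fm
  ◇    : Fm → Fm

¬' : Fm → Fm
¬' A = A ⇒ ⊥'

_⇔_ : Fm → Fm → Fm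
A ⇔ B = (A ⇒ B) ∧' (B ⇒ A)

p q r : Fm
p = atom 0
q = atom 1
r = atom 2

subst : (ℕ → Fm) → Fm → Fm
subst σ (atom n) = σ n
subst σ (A ⇒ B)  = subst σ A ⇒ subst σ B
subst σ ⊤'       = ⊤'
subst σ ⊥'       = ⊥'
subst σ (A ∨' B) = subst σ A ∨' subst σ B
subst σ (A ∧' B) = subst σ A ∧' subst σ B
subst σ (□ A)    = □ (subst σ A)
subst σ (◇ A)    = ◇ (subst σ A)

data IPCAx : Fm → Set where
  ax1  : IPCAx (p ⇒ (q ⇒ p))
  ax2  : IPCAx ((p ⇒ (q ⇒ r)) ⇒ ((p ⇒ q) ⇒ (p ⇒ r)))
  ax3  : IPCAx ((p ∧' q) ⇒ p)
  ax4  : IPCAx ((p ∧' q) ⇒ q)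
  ax5  : IPCAx (p ⇒ (q ⇒ (p ∧' q)))
  ax6  : IPCAx (p ⇒ (p ∨' q))
  ax7  : IPCAx (q ⇒ (p ∨' q))
  ax8  : IPCAx ((p ⇒ r) ⇒ ((q ⇒ r) ⇒ ((p ∨' q) ⇒ r)))
  ax9  : IPCAx (⊥' ⇒ p)
  ax10 : IPCAx ⊤'

data FbdcAx : Fm → Set where
  f : FbdcAx (◇ (p ⇒ q) ⇒ (□ p ⇒ ◇ q))
  b : FbdcAx ((◇ p ⇒ □ q) ⇒ □ (p ⇒ q))
  d : FbdcAx (□ (p ∨' q) ⇒ (◇ p ∨' □ q))

-- L_fbdc = L_min ⊕ {f, b, dc}: the least intuitionistic modal logic containing them
data Lfbdc : Fm → Set where
  ipc  : ∀ {A} → IPCAx A → Lfbdc A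
  A1   : Lfbdc (□ (p ⇒ q) ⇒ (□ p ⇒ □ q))
  A2   : Lfbdc (□ (p ∨' q) ⇒ ((◇ p ⇒ □ q) ⇒ □ q))
  A3   : Lfbdc (◇ (p ∨' q) ⇒ (◇ p ∨' ◇ q))
  A4   : Lfbdc (¬' (◇ ⊥'))
  extra : ∀ {A} → FbdcAx A → Lfbdc A
  us   : ∀ {A} (σ : ℕ → Fm) → Lfbdc A → Lfbdc (subst σ A)
  mp   : ∀ {A B} → Lfbdc (A ⇒ B) → Lfbdc A → Lfbdc B
  R1   : ∀ {A} → Lfbdc A → Lfbdc (□ A)
  R2   : ∀ {A B} → Lfbdc (A ⇒ B) → Lfbdc (◇ A ⇒ ◇ B)
  R3   : ∀ {A B C} → Lfbdc (◇ A ⇒ (B ∨' □ (A ⇒ C))) → Lfbdc (◇ A ⇒ (B ∨' ◇ C))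

-- Classical propositional evaluation: atoms and modalised formulas are
-- treated as propositional variables.
data PVar : Set where
  patom : ℕ → PVar
  pbox  : Fm → PVar
  pdia  : Fm → PVar

evalB : (PVar → Bool) → Fm → Bool
evalB v (atom n) = v (patom n)
evalB v (A ⇒ B)  = not (evalB v A) ∨ evalB v B
evalB v ⊤'       = true
evalB v ⊥'       = false
evalB v (A ∨' B) = evalB v A ∨ evalB v B
evalB v (A ∧' B) = evalB v A ∧ evalB v B
evalB v (□ A)    = v (pbox A)
evalB v (◇ A)    = v (pdia A)

Tautology : Fm → Set
Tautology A = ∀ (v : PVar → Bool) → evalB v A ≡ true

data K : Fm → Set where
  taut : ∀ {A} → Tautology A → K A
  kax  : K (□ (p ⇒ q) ⇒ (□ p ⇒ □ q))
  dual : K (◇ p ⇔ ¬' (□ (¬' p)))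
  mp   : ∀ {A B} → K (A ⇒ B) → K A → K B
  nec  : ∀ {A} → K A → K (□ A)
  us   : ∀ {A} (σ : ℕ → Fm) → K A → K (subst σ A)

-- K proves every axiom of L_fbdc and is closed under its rules: through the
-- duality ◇A ↔ ¬□¬A each modal axiom reduces to monotonicity of □ plus a
-- propositional tautology about □- and ◇-formulas, and such tautologies are
-- checked by truth tables. The inclusion is strict because interpreting □ as
-- ⊤ and ◇ as ⊥ in the three-element Gödel algebra validates L_fbdc, while
-- p ∨ ¬p takes the middle value there.
module Submission where

open import Defs
open import Data.Bool using (Bool; true; false; T; not; _∨_; _∧_)
open import Data.Bool.Properties using (T-≡)
open import Data.Empty using (⊥)
open import Data.List using (List; []; _∷_; length)
open import Data.Nat using (ℕ; zero; suc; _<_; _<ᵇ_; s<s)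
open import Data.Nat.Properties using (<ᵇ⇒<)
open import Data.Product using (Σ; _×_; _,_)
open import Data.Unit using (⊤; tt)
open import Function using (_∘_)
open import Function.Bundles using (Equivalence)
open import Relation.Binary.PropositionalEquality as ≡
  using (_≡_; refl; sym; cong₂; module ≡-Reasoning)
open import Relation.Nullary using (¬_)

open Equivalence using (to)

private
  variable
    A B C : Fm

Propositional : ℕ → Fm → Set
Propositional n (atom k) = T (k <ᵇ n)
Propositional n (A ⇒ B)  = Propositional n A × Propositional n B
Propositional n ⊤'       = ⊤
Propositional n ⊥'       = ⊤
Propositional n (A ∨' B) = Propositional n A × Propositional n B
Propositional n (A ∧' B) = Propositional n A × Propositional n B
Propositional n (□ A)    = ⊥
Propositional n (◇ A)    = ⊥

-- For a concrete formula and a table that is true everywhere, both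
-- Propositional n A and Every n P normalise to products of ⊤, so they are
-- supplied by η as implicit arguments.
module TruthTable {V : Set} (default : V) (ForAll : (V → Set) → Set)
                  (ForAll-elim : ∀ {P} → ForAll P → ∀ x → P x) where

  _∷ᵛ_ : V → (ℕ → V) → ℕ → V
  (x ∷ᵛ ρ) zero    = x
  (x ∷ᵛ ρ) (suc k) = ρ k

  _↾_ : (ℕ → V) → ℕ → ℕ → V
  ρ ↾ zero  = λ _ → default
  ρ ↾ suc n = ρ zero ∷ᵛ ((ρ ∘ suc) ↾ n)

  ↾-agrees : ∀ ρ {n k} → k < n → (ρ ↾ n) k ≡ ρ k
  ↾-agrees ρ {suc n} {zero}  _         = refl
  ↾-agrees ρ {suc n} {suc k} (s<s k<n) = ↾-agrees (ρ ∘ suc) k<n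

  Every : ℕ → ((ℕ → V) → Set) → Set
  Every zero    P = P (λ _ → default)
  Every (suc n) P = ForAll λ x → Every n (λ ρ → P (x ∷ᵛ ρ))

  Every-↾ : ∀ n P → Every n P → ∀ ρ → P (ρ ↾ n)
  Every-↾ zero    P table ρ = table
  Every-↾ (suc n) P table ρ =
    Every-↾ n (λ σ → P (ρ zero ∷ᵛ σ)) (ForAll-elim table (ρ zero)) (ρ ∘ suc)

ForAllBool : (Bool → Set) → Set
ForAllBool P = P true × P false

ForAllBool-elim : ∀ {P} → ForAllBool P → ∀ x → P x
ForAllBool-elim (Ptrue , _)      true  = Ptrue
ForAllBool-elim (_     , Pfalse) false = Pfalse

module BoolTable = TruthTable false ForAllBool ForAllBool-elim

atomValuation : (ℕ → Bool) → PVar → Bool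
atomValuation ρ (patom k) = ρ k
atomValuation ρ (pbox _)  = false
atomValuation ρ (pdia _)  = false

evalB-cong : ∀ n A {v w} → Propositional n A →
             (∀ {k} → k < n → v (patom k) ≡ w (patom k)) → evalB v A ≡ evalB w A
evalB-cong n (atom k) prop      agree = agree (<ᵇ⇒< k n prop)
evalB-cong n (A ⇒ B)  (pA , pB) agree =
  cong₂ (λ a b → not a ∨ b) (evalB-cong n A pA agree) (evalB-cong n B pB agree)
evalB-cong n ⊤'       _         _     = refl
evalB-cong n ⊥'       _         _     = refl
evalB-cong n (A ∨' B) (pA , pB) agree = cong₂ _∨_ (evalB-cong n A pA agree) (evalB-cong n B pB agree)
evalB-cong n (A ∧' B) (pA , pB) agree = cong₂ _∧_ (evalB-cong n A pA agree) (evalB-cong n B pB agree)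

IsTautology : ℕ → Fm → Set
IsTautology n A = Propositional n A × BoolTable.Every n (λ ρ → T (evalB (atomValuation ρ) A))

tautology : ∀ n A → {IsTautology n A} → Tautology A
tautology n A {prop , table} v = begin
  evalB v A                                 ≡⟨ evalB-cong n A prop (sym ∘ BoolTable.↾-agrees ρ) ⟩
  evalB (atomValuation (ρ BoolTable.↾ n)) A ≡⟨ to T-≡ (BoolTable.Every-↾ n _ table ρ) ⟩
  true                                      ∎
  where
    open ≡-Reasoning
    ρ : ℕ → Bool
    ρ = v ∘ patom

⟨_⟩ : List Fm → ℕ → Fm
⟨ []     ⟩ n       = atom n
⟨ A ∷ As ⟩ zero    = A
⟨ A ∷ As ⟩ (suc n) = ⟨ As ⟩ n

s t u : Fm
s = atom 3
t = atom 4
u = atom 5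

-- S is a propositional schema in the atoms p, q, r, s, t, u, … ; its i-th
-- atom is instantiated by the i-th formula of As.
K-taut : (S : Fm) (As : List Fm) → {IsTautology (length As) S} → K (subst ⟨ As ⟩ S)
K-taut S As {isTaut} = us ⟨ As ⟩ (taut {S} (tautology (length As) S {isTaut}))

infixl 4 _·_
_·_ : K (A ⇒ B) → K A → K B
_·_ = mp

□-mono : K (A ⇒ B) → K (□ A ⇒ □ B)
□-mono {A} {B} h = us ⟨ A ∷ B ∷ [] ⟩ kax · nec h

□-mono₂ : K (A ⇒ B ⇒ C) → K (□ A ⇒ □ B ⇒ □ C)
□-mono₂ {A} {B} {C} h =
  K-taut ((p ⇒ q) ⇒ (q ⇒ r) ⇒ p ⇒ r) (□ A ∷ □ (B ⇒ C) ∷ (□ B ⇒ □ C) ∷ [])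
    · □-mono h · us ⟨ B ∷ C ∷ [] ⟩ kax

◇∨□¬ : ∀ A → K (◇ A ∨' □ (¬' A))
◇∨□¬ A = K-taut ((p ⇔ ¬' q) ⇒ p ∨' q) (◇ A ∷ □ (¬' A) ∷ []) · us ⟨ A ∷ [] ⟩ dual

◇⇒¬□¬ : ∀ A → K (◇ A ⇒ ¬' (□ (¬' A)))
◇⇒¬□¬ A = K-taut ((p ⇔ ¬' q) ⇒ p ⇒ ¬' q) (◇ A ∷ □ (¬' A) ∷ []) · us ⟨ A ∷ [] ⟩ dual

◇-K : ∀ A B → K (□ (A ⇒ B) ⇒ ◇ A ⇒ ◇ B)
◇-K A B =
  K-taut ((p ⇒ ¬' q) ⇒ r ∨' s ⇒ (t ⇒ s ⇒ q) ⇒ t ⇒ p ⇒ r)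
         (◇ A ∷ □ (¬' A) ∷ ◇ B ∷ □ (¬' B) ∷ □ (A ⇒ B) ∷ [])
    · ◇⇒¬□¬ A · ◇∨□¬ B · □-mono₂ (K-taut ((p ⇒ q) ⇒ ¬' q ⇒ ¬' p) (A ∷ B ∷ []))

ipc⊆K : IPCAx A → K A
ipc⊆K {A} ax1  = taut (tautology 3 A)
ipc⊆K {A} ax2  = taut (tautology 3 A)
ipc⊆K {A} ax3  = taut (tautology 3 A)
ipc⊆K {A} ax4  = taut (tautology 3 A)
ipc⊆K {A} ax5  = taut (tautology 3 A)
ipc⊆K {A} ax6  = taut (tautology 3 A)
ipc⊆K {A} ax7  = taut (tautology 3 A)
ipc⊆K {A} ax8  = taut (tautology 3 A)
ipc⊆K {A} ax9  = taut (tautology 3 A)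
ipc⊆K {A} ax10 = taut (tautology 3 A)

Lfbdc⊆K : Lfbdc A → K A
Lfbdc⊆K (ipc a) = ipc⊆K a
Lfbdc⊆K A1      = kax
Lfbdc⊆K A2 =
  K-taut (p ∨' q ⇒ (r ⇒ q ⇒ s) ⇒ r ⇒ (p ⇒ s) ⇒ s) (◇ p ∷ □ (¬' p) ∷ □ (p ∨' q) ∷ □ q ∷ [])
    · ◇∨□¬ p · □-mono₂ (K-taut (p ∨' q ⇒ ¬' p ⇒ q) (p ∷ q ∷ []))
Lfbdc⊆K A3 =
  K-taut (p ∨' q ⇒ r ∨' s ⇒ (q ⇒ s ⇒ u) ⇒ (t ⇒ ¬' u) ⇒ t ⇒ p ∨' r)
         (◇ p ∷ □ (¬' p) ∷ ◇ q ∷ □ (¬' q) ∷ ◇ (p ∨' q) ∷ □ (¬' (p ∨' q)) ∷ [])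
    · ◇∨□¬ p · ◇∨□¬ q · □-mono₂ (K-taut (¬' p ⇒ ¬' q ⇒ ¬' (p ∨' q)) (p ∷ q ∷ []))
    · ◇⇒¬□¬ (p ∨' q)
Lfbdc⊆K A4 =
  K-taut ((p ⇒ ¬' q) ⇒ q ⇒ ¬' p) (◇ ⊥' ∷ □ (¬' ⊥') ∷ [])
    · ◇⇒¬□¬ ⊥' · nec (K-taut (¬' ⊥') [])
Lfbdc⊆K (extra f) =
  K-taut ((p ⇒ q) ⇒ (q ⇒ r ⇒ s) ⇒ r ⇒ p ⇒ s) (□ p ∷ □ ((p ⇒ q) ⇒ q) ∷ ◇ (p ⇒ q) ∷ ◇ q ∷ [])
    · □-mono (K-taut (p ⇒ (p ⇒ q) ⇒ q) (p ∷ q ∷ [])) · ◇-K (p ⇒ q) q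
Lfbdc⊆K (extra b) =
  K-taut (p ∨' q ⇒ (r ⇒ s) ⇒ (q ⇒ s) ⇒ (p ⇒ r) ⇒ s) (◇ p ∷ □ (¬' p) ∷ □ q ∷ □ (p ⇒ q) ∷ [])
    · ◇∨□¬ p · □-mono (K-taut (q ⇒ p ⇒ q) (p ∷ q ∷ [])) · □-mono (K-taut (¬' p ⇒ p ⇒ q) (p ∷ q ∷ []))
Lfbdc⊆K (extra d) =
  K-taut (p ∨' q ⇒ (r ⇒ q ⇒ s) ⇒ r ⇒ p ∨' s) (◇ p ∷ □ (¬' p) ∷ □ (p ∨' q) ∷ □ q ∷ [])
    · ◇∨□¬ p · □-mono₂ (K-taut (p ∨' q ⇒ ¬' p ⇒ q) (p ∷ q ∷ []))
Lfbdc⊆K (us σ h) = us σ (Lfbdc⊆K h)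
Lfbdc⊆K (mp h h′) = Lfbdc⊆K h · Lfbdc⊆K h′
Lfbdc⊆K (R1 h) = nec (Lfbdc⊆K h)
Lfbdc⊆K (R2 {A} {B} h) = ◇-K A B · nec (Lfbdc⊆K h)
Lfbdc⊆K (R3 {A} {B} {C} h) =
  K-taut ((p ⇒ q ∨' r) ⇒ (r ⇒ p ⇒ s) ⇒ p ⇒ q ∨' s) (◇ A ∷ B ∷ □ (A ⇒ C) ∷ ◇ C ∷ [])
    · Lfbdc⊆K h · ◇-K A C

data G₃ : Set where
  bot mid top : G₃

_⇒₃_ : G₃ → G₃ → G₃
bot ⇒₃ _   = top
mid ⇒₃ bot = bot
mid ⇒₃ _   = top
top ⇒₃ y   = y

_∨₃_ : G₃ → G₃ → G₃
bot ∨₃ y   = y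
mid ∨₃ top = top
mid ∨₃ _   = mid
top ∨₃ _   = top

_∧₃_ : G₃ → G₃ → G₃
bot ∧₃ _   = bot
mid ∧₃ bot = bot
mid ∧₃ _   = mid
top ∧₃ y   = y

Designated : G₃ → Set
Designated top = ⊤
Designated _   = ⊥

Designated-mp : ∀ x y → Designated (x ⇒₃ y) → Designated x → Designated y
Designated-mp top y y-designated _ = y-designated

⟦_⟧ : Fm → (ℕ → G₃) → G₃
⟦ atom n ⟧ ρ = ρ n
⟦ A ⇒ B ⟧  ρ = ⟦ A ⟧ ρ ⇒₃ ⟦ B ⟧ ρ
⟦ ⊤' ⟧     ρ = top
⟦ ⊥' ⟧     ρ = bot
⟦ A ∨' B ⟧ ρ = ⟦ A ⟧ ρ ∨₃ ⟦ B ⟧ ρ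
⟦ A ∧' B ⟧ ρ = ⟦ A ⟧ ρ ∧₃ ⟦ B ⟧ ρ
⟦ □ A ⟧    ρ = top
⟦ ◇ A ⟧    ρ = bot

⟦⟧-subst : ∀ σ A ρ → ⟦ subst σ A ⟧ ρ ≡ ⟦ A ⟧ (λ n → ⟦ σ n ⟧ ρ)
⟦⟧-subst σ (atom n) ρ = refl
⟦⟧-subst σ (A ⇒ B)  ρ = cong₂ _⇒₃_ (⟦⟧-subst σ A ρ) (⟦⟧-subst σ B ρ)
⟦⟧-subst σ ⊤'       ρ = refl
⟦⟧-subst σ ⊥'       ρ = refl
⟦⟧-subst σ (A ∨' B) ρ = cong₂ _∨₃_ (⟦⟧-subst σ A ρ) (⟦⟧-subst σ B ρ)
⟦⟧-subst σ (A ∧' B) ρ = cong₂ _∧₃_ (⟦⟧-subst σ A ρ) (⟦⟧-subst σ B ρ)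
⟦⟧-subst σ (□ A)    ρ = refl
⟦⟧-subst σ (◇ A)    ρ = refl

⟦⟧-cong : ∀ n A {ρ ρ′} → Propositional n A → (∀ {k} → k < n → ρ k ≡ ρ′ k) → ⟦ A ⟧ ρ ≡ ⟦ A ⟧ ρ′
⟦⟧-cong n (atom k) prop      agree = agree (<ᵇ⇒< k n prop)
⟦⟧-cong n (A ⇒ B)  (pA , pB) agree = cong₂ _⇒₃_ (⟦⟧-cong n A pA agree) (⟦⟧-cong n B pB agree)
⟦⟧-cong n ⊤'       _         _     = refl
⟦⟧-cong n ⊥'       _         _     = refl
⟦⟧-cong n (A ∨' B) (pA , pB) agree = cong₂ _∨₃_ (⟦⟧-cong n A pA agree) (⟦⟧-cong n B pB agree)
⟦⟧-cong n (A ∧' B) (pA , pB) agree = cong₂ _∧₃_ (⟦⟧-cong n A pA agree) (⟦⟧-cong n B pB agree)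

ForAllG₃ : (G₃ → Set) → Set
ForAllG₃ P = P bot × P mid × P top

ForAllG₃-elim : ∀ {P} → ForAllG₃ P → ∀ x → P x
ForAllG₃-elim (Pbot , _    , _   ) bot = Pbot
ForAllG₃-elim (_    , Pmid , _   ) mid = Pmid
ForAllG₃-elim (_    , _    , Ptop) top = Ptop

module G₃Table = TruthTable bot ForAllG₃ ForAllG₃-elim

Valid₃ : Fm → Set
Valid₃ A = ∀ ρ → Designated (⟦ A ⟧ ρ)

valid₃ : ∀ n A → {Propositional n A} → {G₃Table.Every n (Designated ∘ ⟦ A ⟧)} → Valid₃ A
valid₃ n A {prop} {table} ρ =
  ≡.subst Designated (⟦⟧-cong n A prop (G₃Table.↾-agrees ρ)) (G₃Table.Every-↾ n _ table ρ)

ipc-valid₃ : IPCAx A → Valid₃ A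
ipc-valid₃ {A} ax1  = valid₃ 3 A
ipc-valid₃ {A} ax2  = valid₃ 3 A
ipc-valid₃ {A} ax3  = valid₃ 3 A
ipc-valid₃ {A} ax4  = valid₃ 3 A
ipc-valid₃ {A} ax5  = valid₃ 3 A
ipc-valid₃ {A} ax6  = valid₃ 3 A
ipc-valid₃ {A} ax7  = valid₃ 3 A
ipc-valid₃ {A} ax8  = valid₃ 3 A
ipc-valid₃ {A} ax9  = valid₃ 3 A
ipc-valid₃ {A} ax10 = valid₃ 3 A

Lfbdc⊆Valid₃ : Lfbdc A → Valid₃ A
Lfbdc⊆Valid₃ (ipc a)   = ipc-valid₃ a
Lfbdc⊆Valid₃ A1        = λ _ → tt
Lfbdc⊆Valid₃ A2        = λ _ → tt
Lfbdc⊆Valid₃ A3        = λ _ → tt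
Lfbdc⊆Valid₃ A4        = λ _ → tt
Lfbdc⊆Valid₃ (extra f) = λ _ → tt
Lfbdc⊆Valid₃ (extra b) = λ _ → tt
Lfbdc⊆Valid₃ (extra d) = λ _ → tt
Lfbdc⊆Valid₃ (us {A} σ h) ρ =
  ≡.subst Designated (sym (⟦⟧-subst σ A ρ)) (Lfbdc⊆Valid₃ h _)
Lfbdc⊆Valid₃ (mp {A} {B} h h′) ρ =
  Designated-mp (⟦ A ⟧ ρ) (⟦ B ⟧ ρ) (Lfbdc⊆Valid₃ h ρ) (Lfbdc⊆Valid₃ h′ ρ)
Lfbdc⊆Valid₃ (R1 h)    = λ _ → tt
Lfbdc⊆Valid₃ (R2 h)    = λ _ → tt
Lfbdc⊆Valid₃ (R3 h)    = λ _ → tt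

excluded-middle∉Lfbdc : ¬ Lfbdc (p ∨' ¬' p)
excluded-middle∉Lfbdc h = Lfbdc⊆Valid₃ h (λ _ → mid)

mainTheorem9 : ((A : Fm) → Lfbdc A → K A) × Σ Fm (λ A → K A × ¬ Lfbdc A)
mainTheorem9 =
  (λ _ → Lfbdc⊆K) , p ∨' ¬' p , taut (tautology 1 (p ∨' ¬' p)) , excluded-middle∉Lfbdc
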